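{- For every $n\geq 2$, $\chi'_{sCF}(K_n)\leq 2\lceil\log_2 n\rceil$.
   Context: For a graph $H$ and a vertex $v$, let $E_H(v)$ be the set of edges of $H$ incident to $v$, and for a pair $u,v$ let $E_H[uv]=E_H(u)\cup E_H(v)$. Given a graph $G$ and an edge colouring $c$ (not necessarily proper) of some subgraph $H$ of $G$, an edge $e$ of $G$ is satisfied by $c$ if the multiset $\{c(e'): e'\in E_H[e]\}$ contains a colour occurring exactly once in it. The parameter $\chi'_{sCF}(G)$ is the least number of colours for which there exist a subgraph $H$ of $G$ and an edge colouring of $H$ with that many colours satisfying every edge of $G$. -}

module Defs where

open import Level using (0ℓ)
open import Data.Nat using (ℕ)
open import Data.Fin using (Fin)
open import Data.Maybe using (Maybe; just)
open import Data.Product using (Σ; ∃; ∃-syntax; _×_; _,_)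
open import Data.Sum using (_⊎_)
open import Relation.Nullary using (¬_)
open import Relation.Binary.PropositionalEquality using (_≡_; _≢_)

-- A (simple, loopless) graph on vertex set Fin n, given by its adjacency
-- relation; an edge {a,b} is represented by either ordered pair (a,b)/(b,a).
Graph : ℕ → Set₁
Graph n = Fin n → Fin n → Set

K : (n : ℕ) → Graph n
K n a b = a ≢ b

-- A partial edge colouring of G with colours Fin k: c a b ≡ just j means the
-- edge ab belongs to the subgraph H and has colour j; c a b ≡ nothing means
-- ab ∉ H.
IsPartialEdgeColouring : {n : ℕ} → Graph n → (k : ℕ) →
                         (Fin n → Fin n → Maybe (Fin k)) → Set
IsPartialEdgeColouring {n} G k c =
  (∀ (a b : Fin n) → c a b ≡ c b a) ×
  (∀ (a b : Fin n) (j : Fin k) → c a b ≡ just j → G a b)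

Incident : {n : ℕ} → Fin n → Fin n → Fin n → Fin n → Set
Incident u v a b = (a ≡ u ⊎ a ≡ v) ⊎ (b ≡ u ⊎ b ≡ v)

SameEdge : {n : ℕ} → Fin n → Fin n → Fin n → Fin n → Set
SameEdge a b a' b' = (a' ≡ a × b' ≡ b) ⊎ (a' ≡ b × b' ≡ a)

-- The edge uv is satisfied by c: some colour j occurs exactly once in the
-- multiset of colours of edges of H in E_H(u) ∪ E_H(v), i.e. there is an
-- edge ab of H in E_H[uv] coloured j, and every edge of H in E_H[uv]
-- coloured j is that same edge.
Satisfied : {n k : ℕ} → (Fin n → Fin n → Maybe (Fin k)) → Fin n → Fin n → Set
Satisfied {n} {k} c u v =
  ∃[ j ] ∃[ a ] ∃[ b ]
    (Incident u v a b × c a b ≡ just j ×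
     (∀ (a' b' : Fin n) → Incident u v a' b' → c a' b' ≡ just j →
        SameEdge a b a' b'))

χ'sCF≤ : {n : ℕ} → Graph n → ℕ → Set
χ'sCF≤ {n} G k =
  Σ (Fin n → Fin n → Maybe (Fin k)) λ c →
    IsPartialEdgeColouring G k c × (∀ (u v : Fin n) → G u v → Satisfied c u v)

-- Number the vertices 0, …, n - 1 in binary with L = ⌈log₂ n⌉ bits and colour
-- only the hypercube edges: an edge whose endpoints differ exactly in bit i gets
-- colour (i, bit i+1 of the endpoints), giving 2L colours and a proper colouring.
-- If u and v differ only in bit 0, the edge uv itself has a colour seen once on
-- E[uv]. Otherwise let i ≥ 1 be the highest bit in which they differ, say with
-- bit i of v equal to 0 and of u equal to 1. Flipping bit i - 1 of v gives a
-- vertex w < u, and the colour (i - 1, 0) of vw occurs at v only on vw and does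
-- not occur at u at all, since the edge of u in direction i - 1 has colour (i - 1, 1).
module Submission where

open import Defs
open import Data.Nat
open import Data.Nat.Properties
open import Data.Nat.Induction using (<-wellFounded)
open import Data.Nat.Logarithm using (⌈log₂_⌉)
open import Data.Nat.Logarithm.Core using (⌈log2⌉)
open import Data.Parity.Base using (Parity; 0ℙ; 1ℙ; _⁻¹)
open import Data.Parity.Properties as ℙₚ using (p≢p⁻¹)
open import Data.Fin.Base using (Fin; toℕ; fromℕ<)
open import Data.Fin.Properties using (toℕ-injective; toℕ-fromℕ<; toℕ<n; any?)
open import Data.Maybe.Base as Maybe using (Maybe; just; nothing)
open import Data.Product.Base using (∃; ∃₂; _×_; _,_; proj₁; uncurry)
open import Data.Sum.Base using (inj₁; inj₂)
open import Function.Base using (_∘_; case_of_)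
open import Induction.WellFounded using (Acc; acc)
open import Relation.Nullary.Negation using (¬_; contradiction)
open import Relation.Nullary.Decidable using (Dec; yes; no; map′; ¬?; _×-dec_; dec⇒maybe)
open import Relation.Binary.PropositionalEquality
open import Relation.Binary.Definitions using (tri<; tri≈; tri>)

private
  variable
    n L i j : ℕ
    x y z : ℕ
    b c : Parity

-- b ∷₂ m = 2 m + b, i.e. the bits of m followed by the lowest bit b.
infixr 5 _∷₂_

_∷₂_ : Parity → ℕ → ℕ
b  ∷₂ suc m = suc (suc (b ∷₂ m))
0ℙ ∷₂ zero  = 0
1ℙ ∷₂ zero  = 1

⌊[b∷₂m]/2⌋≡m : ∀ b m → ⌊ b ∷₂ m /2⌋ ≡ m
⌊[b∷₂m]/2⌋≡m 0ℙ zero    = refl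
⌊[b∷₂m]/2⌋≡m 1ℙ zero    = refl
⌊[b∷₂m]/2⌋≡m b  (suc m) = cong suc (⌊[b∷₂m]/2⌋≡m b m)

parity[b∷₂m]≡b : ∀ b m → parity (b ∷₂ m) ≡ b
parity[b∷₂m]≡b 0ℙ zero    = refl
parity[b∷₂m]≡b 1ℙ zero    = refl
parity[b∷₂m]≡b b  (suc m) = parity[b∷₂m]≡b b m

∷₂-<-2* : ∀ b {m L} → m < L → b ∷₂ m < 2 * L
∷₂-<-2* 0ℙ {zero}  {suc L} _ = z<s
∷₂-<-2* 1ℙ {zero}  {suc L} _ = subst (1 <_) (sym (*-suc 2 L)) (s<s z<s)
∷₂-<-2* b  {suc m} {suc L} m<L =
  subst (b ∷₂ suc m <_) (sym (*-suc 2 L)) (s<s (s<s (∷₂-<-2* b (s<s⁻¹ m<L))))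

⌊/2⌋-parity-injective : ⌊ x /2⌋ ≡ ⌊ y /2⌋ → parity x ≡ parity y → x ≡ y
⌊/2⌋-parity-injective {zero}        {zero}        _ _ = refl
⌊/2⌋-parity-injective {suc zero}    {suc zero}    _ _ = refl
⌊/2⌋-parity-injective {suc (suc x)} {suc (suc y)} h p =
  cong (suc ∘ suc) (⌊/2⌋-parity-injective (suc-injective h) p)
⌊/2⌋-parity-injective {zero}        {suc zero}    _ ()
⌊/2⌋-parity-injective {suc zero}    {zero}        _ ()
⌊/2⌋-parity-injective {zero}        {suc (suc y)} ()
⌊/2⌋-parity-injective {suc zero}    {suc (suc y)} ()
⌊/2⌋-parity-injective {suc (suc x)} {zero}        ()
⌊/2⌋-parity-injective {suc (suc x)} {suc zero}    ()

≢⇒≡⁻¹ : ∀ {b c} → b ≢ c → c ≡ b ⁻¹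
≢⇒≡⁻¹ {0ℙ} {0ℙ} b≢c = contradiction refl b≢c
≢⇒≡⁻¹ {0ℙ} {1ℙ} _   = refl
≢⇒≡⁻¹ {1ℙ} {0ℙ} _   = refl
≢⇒≡⁻¹ {1ℙ} {1ℙ} b≢c = contradiction refl b≢c

sibling-parity : ⌊ x /2⌋ ≡ ⌊ y /2⌋ → x ≢ y → parity y ≡ parity x ⁻¹
sibling-parity h x≢y = ≢⇒≡⁻¹ (x≢y ∘ ⌊/2⌋-parity-injective h)

lower-sibling-even : ⌊ x /2⌋ ≡ ⌊ y /2⌋ → x < y → parity x ≡ 0ℙ
lower-sibling-even {zero}        {_}           _ _  = refl
lower-sibling-even {suc zero}    {suc (suc y)} () _
lower-sibling-even {suc (suc x)} {suc (suc y)} h lt =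
  lower-sibling-even (suc-injective h) (s<s⁻¹ (s<s⁻¹ lt))
lower-sibling-even {suc zero}    {zero}        _ ()
lower-sibling-even {suc zero}    {suc zero}    _ (s<s ())
lower-sibling-even {suc (suc x)} {zero}        _ ()
lower-sibling-even {suc (suc x)} {suc zero}    _ (s<s ())

⌊n/2⌋<m : ∀ {n m} → n < 2 * m → ⌊ n /2⌋ < m
⌊n/2⌋<m {zero}        {suc m} _  = z<s
⌊n/2⌋<m {suc zero}    {suc m} _  = z<s
⌊n/2⌋<m {suc (suc n)} {suc m} lt =
  s<s (⌊n/2⌋<m (s<s⁻¹ (s<s⁻¹ (subst (suc (suc n) <_) (*-suc 2 m) lt))))

∷₂-< : ∀ b {m} → m < ⌊ x /2⌋ → b ∷₂ m < x
∷₂-< b {m} m<⌊x/2⌋ =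
  ≰⇒> (<⇒≱ (subst (_< _) (sym (⌊[b∷₂m]/2⌋≡m b m)) m<⌊x/2⌋) ∘ ⌊n/2⌋-mono)

n≤2*⌈n/2⌉ : ∀ n → n ≤ 2 * ⌈ n /2⌉
n≤2*⌈n/2⌉ n = begin
  n                       ≡⟨ ⌊n/2⌋+⌈n/2⌉≡n n ⟨
  ⌊ n /2⌋ + ⌈ n /2⌉       ≤⟨ +-monoˡ-≤ ⌈ n /2⌉ (⌊n/2⌋≤⌈n/2⌉ n) ⟩
  ⌈ n /2⌉ + ⌈ n /2⌉       ≡⟨ cong (⌈ n /2⌉ +_) (+-identityʳ ⌈ n /2⌉) ⟨
  2 * ⌈ n /2⌉             ∎
  where open ≤-Reasoning

n≤2^⌈log2⌉n : ∀ n (rec : Acc _<_ n) → n ≤ 2 ^ ⌈log2⌉ n rec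
n≤2^⌈log2⌉n zero          _        = z≤n
n≤2^⌈log2⌉n (suc zero)    _        = ≤-refl
n≤2^⌈log2⌉n (suc (suc n)) (acc rs) = begin
  suc (suc n)                   ≤⟨ s≤s (s≤s (n≤2*⌈n/2⌉ n)) ⟩
  2 + 2 * ⌈ n /2⌉               ≡⟨ *-suc 2 ⌈ n /2⌉ ⟨
  2 * suc ⌈ n /2⌉               ≤⟨ *-monoʳ-≤ 2 (n≤2^⌈log2⌉n (suc ⌈ n /2⌉) _) ⟩
  2 ^ ⌈log2⌉ (suc (suc n)) (acc rs) ∎
  where open ≤-Reasoning

n≤2^⌈log₂n⌉ : ∀ n → n ≤ 2 ^ ⌈log₂ n ⌉
n≤2^⌈log₂n⌉ n = n≤2^⌈log2⌉n n (<-wellFounded n)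

-- Edge x y i b : x and y differ exactly in bit i, and their bit i + 1 is b.
data Edge : ℕ → ℕ → ℕ → Parity → Set where
  here  : x ≢ y → ⌊ x /2⌋ ≡ ⌊ y /2⌋ → parity ⌊ x /2⌋ ≡ b → Edge x y 0 b
  there : parity x ≡ parity y → Edge ⌊ x /2⌋ ⌊ y /2⌋ i b → Edge x y (suc i) b

edge-irrefl : Edge x y i b → x ≢ y
edge-irrefl (here x≢y _ _) = x≢y
edge-irrefl (there _ e)    = edge-irrefl e ∘ cong ⌊_/2⌋

edge-sym : Edge x y i b → Edge y x i b
edge-sym (here x≢y h p) = here (x≢y ∘ sym) (sym h) (trans (cong parity (sym h)) p)
edge-sym (there p e)    = there (sym p) (edge-sym e)

edge-neighbour-unique : Edge x y i b → Edge x z i c → y ≡ z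
edge-neighbour-unique (here x≢y hy _) (here x≢z hz _) =
  ⌊/2⌋-parity-injective (trans (sym hy) hz)
    (trans (sibling-parity hy x≢y) (sym (sibling-parity hz x≢z)))
edge-neighbour-unique (there py ey) (there pz ez) =
  ⌊/2⌋-parity-injective (edge-neighbour-unique ey ez) (trans (sym py) pz)

edge-label-unique : Edge x y i b → Edge x y j c → i ≡ j × b ≡ c
edge-label-unique (here _ _ pb)   (here _ _ pc)   = refl , trans (sym pb) pc
edge-label-unique (here x≢y h _)  (there p _)     = contradiction (⌊/2⌋-parity-injective h p) x≢y
edge-label-unique (there p _)     (here x≢y h _)  = contradiction (⌊/2⌋-parity-injective h p) x≢y
edge-label-unique (there _ e)     (there _ e′)    =
  let i≡j , b≡c = edge-label-unique e e′ in cong suc i≡j , b≡c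

edge-position-< : Edge x y i b → x < 2 ^ L → y < 2 ^ L → i < L
edge-position-< {L = zero}  e x<1 y<1 =
  contradiction (trans (n<1⇒n≡0 x<1) (sym (n<1⇒n≡0 y<1))) (edge-irrefl e)
edge-position-< {L = suc L} (here _ _ _) _   _   = z<s
edge-position-< {L = suc L} (there _ e)  x<2^L y<2^L =
  s<s (edge-position-< e (⌊n/2⌋<m x<2^L) (⌊n/2⌋<m y<2^L))

edge? : ∀ i b x y → Dec (Edge x y i b)
edge? zero b x y =
  map′ (λ (x≢y , h , p) → here x≢y h p) (λ { (here x≢y h p) → x≢y , h , p })
       (¬? (x ≟ y) ×-dec ⌊ x /2⌋ ≟ ⌊ y /2⌋ ×-dec parity ⌊ x /2⌋ ℙₚ.≟ b)
edge? (suc i) b x y =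
  map′ (uncurry there) (λ { (there p e) → p , e })
       (parity x ℙₚ.≟ parity y ×-dec edge? i b ⌊ x /2⌋ ⌊ y /2⌋)

ExclusiveEdge : ℕ → ℕ → Set
ExclusiveEdge x y = ∃₂ λ i w → w < x × Edge y w i 0ℙ × (∀ z → ¬ Edge x z i 0ℙ)

exclusiveEdge : ⌊ y /2⌋ < ⌊ x /2⌋ → ExclusiveEdge x y
exclusiveEdge = go (<-wellFounded _)
  where
  go : Acc _<_ x → ⌊ y /2⌋ < ⌊ x /2⌋ → ExclusiveEdge x y
  go {x = suc x} {y} (acc rs) lt with ⌊ ⌊ suc x /2⌋ /2⌋ ≟ ⌊ ⌊ y /2⌋ /2⌋
  ... | yes hh = 0 , w , w<x , here y≢w (sym (⌊[b∷₂m]/2⌋≡m _ _)) ⌊y/2⌋-even , no-edge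
    where
    ⌊y/2⌋-even : parity ⌊ y /2⌋ ≡ 0ℙ
    ⌊y/2⌋-even = lower-sibling-even (sym hh) lt
    ⌊x/2⌋-odd : parity ⌊ suc x /2⌋ ≡ 1ℙ
    ⌊x/2⌋-odd = trans (sibling-parity (sym hh) (<⇒≢ lt)) (cong _⁻¹ ⌊y/2⌋-even)
    w = parity y ⁻¹ ∷₂ ⌊ y /2⌋
    y≢w : y ≢ w
    y≢w y≡w =
      p≢p⁻¹ (parity y) (trans (cong parity y≡w) (parity[b∷₂m]≡b (parity y ⁻¹) ⌊ y /2⌋))
    w<x : w < suc x
    w<x = ∷₂-< (parity y ⁻¹) lt
    no-edge : ∀ z → ¬ Edge (suc x) z 0 0ℙ
    no-edge z (here _ _ even) with trans (sym even) ⌊x/2⌋-odd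
    ... | ()
  ... | no hh≢ with go (rs (⌊n/2⌋<n x)) (≤∧≢⇒< (⌊n/2⌋-mono (<⇒≤ lt)) (hh≢ ∘ sym))
  ...   | i , w′ , w′<⌊x/2⌋ , e , no-edge = suc i , w , w<x , there parity-w e′ , no-edge′
    where
    w = parity y ∷₂ w′
    parity-w : parity y ≡ parity w
    parity-w = sym (parity[b∷₂m]≡b (parity y) w′)
    e′ : Edge ⌊ y /2⌋ ⌊ w /2⌋ i 0ℙ
    e′ = subst (λ v → Edge ⌊ y /2⌋ v i 0ℙ) (sym (⌊[b∷₂m]/2⌋≡m _ _)) e
    w<x : w < suc x
    w<x = ∷₂-< (parity y) w′<⌊x/2⌋
    no-edge′ : ∀ z → ¬ Edge (suc x) z (suc i) 0ℙ
    no-edge′ z (there _ e″) = no-edge _ e″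

module ProperColouring {n k : ℕ} (c : Fin n → Fin n → Maybe (Fin k))
         (c-sym : ∀ a b → c a b ≡ c b a)
         (c-proper : ∀ {a b b′ j} → c a b ≡ just j → c a b′ ≡ just j → b ≡ b′)
         where

  satisfied-sym : ∀ {u v} → Satisfied c v u → Satisfied c u v
  satisfied-sym (j , a , b , inc , ab , unique) =
    j , a , b , swap inc , ab , λ a′ b′ → unique a′ b′ ∘ swap
    where
    swap : ∀ {u v a b : Fin n} → Incident v u a b → Incident u v a b
    swap (inj₁ (inj₁ a≡v)) = inj₁ (inj₂ a≡v)
    swap (inj₁ (inj₂ a≡u)) = inj₁ (inj₁ a≡u)
    swap (inj₂ (inj₁ b≡v)) = inj₂ (inj₂ b≡v)
    swap (inj₂ (inj₂ b≡u)) = inj₂ (inj₁ b≡u)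

  satisfied-by-edge : ∀ {u v j} → c u v ≡ just j → Satisfied c u v
  satisfied-by-edge {u} {v} {j} uv = j , u , v , inj₁ (inj₁ refl) , uv , unique
    where
    vu : c v u ≡ just j
    vu = trans (c-sym v u) uv
    unique : ∀ a b → Incident u v a b → c a b ≡ just j → SameEdge u v a b
    unique a b (inj₁ (inj₁ refl)) ab = inj₁ (refl , c-proper ab uv)
    unique a b (inj₁ (inj₂ refl)) ab = inj₂ (refl , c-proper ab vu)
    unique a b (inj₂ (inj₁ refl)) ab = inj₂ (c-proper (trans (c-sym u a) ab) uv , refl)
    unique a b (inj₂ (inj₂ refl)) ab = inj₁ (c-proper (trans (c-sym v a) ab) vu , refl)

  satisfied-by-exclusive : ∀ {u v w j} → c v w ≡ just j → (∀ x → c u x ≢ just j) →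
                           Satisfied c u v
  satisfied-by-exclusive {u} {v} {w} {j} vw absent =
    j , v , w , inj₁ (inj₂ refl) , vw , unique
    where
    unique : ∀ a b → Incident u v a b → c a b ≡ just j → SameEdge v w a b
    unique a b (inj₁ (inj₁ refl)) ab = contradiction ab (absent b)
    unique a b (inj₁ (inj₂ refl)) ab = inj₁ (refl , c-proper ab vw)
    unique a b (inj₂ (inj₁ refl)) ab = contradiction (trans (c-sym u a) ab) (absent a)
    unique a b (inj₂ (inj₂ refl)) ab = inj₂ (c-proper (trans (c-sym v a) ab) vw , refl)

-- The colour with number b ∷₂ i is given to the edges with label (i , b).
module _ (L : ℕ) where

  Coloured : Fin n → Fin n → Fin (2 * L) → Set
  Coloured a b k = Edge (toℕ a) (toℕ b) ⌊ toℕ k /2⌋ (parity (toℕ k))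

  coloured? : ∀ (a b : Fin n) k → Dec (Coloured a b k)
  coloured? a b k = edge? ⌊ toℕ k /2⌋ (parity (toℕ k)) (toℕ a) (toℕ b)

  hypercubeColouring : Fin n → Fin n → Maybe (Fin (2 * L))
  hypercubeColouring a b = Maybe.map proj₁ (dec⇒maybe (any? (coloured? a b)))

  colouring-sound : ∀ {a b : Fin n} {k} → hypercubeColouring a b ≡ just k → Coloured a b k
  colouring-sound {a = a} {b} eq with any? (coloured? a b)
  colouring-sound refl | yes (_ , ab) = ab

  colouring-complete : ∀ {a b : Fin n} {k} → Coloured a b k → hypercubeColouring a b ≡ just k
  colouring-complete {a = a} {b} ab with any? (coloured? a b)
  ... | yes (_ , ab′) =
    cong just (toℕ-injective (uncurry ⌊/2⌋-parity-injective (edge-label-unique ab′ ab)))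
  ... | no ¬ab        = contradiction (_ , ab) ¬ab

  colouring-sym : ∀ (a b : Fin n) → hypercubeColouring a b ≡ hypercubeColouring b a
  colouring-sym a b with hypercubeColouring a b in ab | hypercubeColouring b a in ba
  ... | just k  | _       =
    sym (trans (sym ba) (colouring-complete (edge-sym (colouring-sound ab))))
  ... | nothing | just k  =
    case trans (sym ab) (colouring-complete (edge-sym (colouring-sound ba))) of λ ()
  ... | nothing | nothing = refl

  colouring-proper : ∀ {a b b′ : Fin n} {k} → hypercubeColouring a b ≡ just k →
                     hypercubeColouring a b′ ≡ just k → b ≡ b′
  colouring-proper ab ab′ =
    toℕ-injective (edge-neighbour-unique (colouring-sound ab) (colouring-sound ab′))

  colouring-irrefl : ∀ {a b : Fin n} {k} → hypercubeColouring a b ≡ just k → a ≢ b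
  colouring-irrefl ab = edge-irrefl (colouring-sound ab) ∘ cong toℕ

  module _ (n≤2^L : n ≤ 2 ^ L) where

    open ProperColouring (hypercubeColouring {n}) colouring-sym colouring-proper

    edge-coloured : ∀ {a b : Fin n} {i p} (e : Edge (toℕ a) (toℕ b) i p) →
                    ∃ λ k → hypercubeColouring a b ≡ just k × ⌊ toℕ k /2⌋ ≡ i × parity (toℕ k) ≡ p
    edge-coloured {a} {b} {i} {p} e =
      k , colouring-complete (subst₂ (Edge (toℕ a) (toℕ b)) (sym ⌊k/2⌋≡i) (sym parity-k≡p) e) ,
      ⌊k/2⌋≡i , parity-k≡p
      where
      bounded : ∀ (x : Fin n) → toℕ x < 2 ^ L
      bounded x = <-≤-trans (toℕ<n x) n≤2^L
      p∷₂i<2L : p ∷₂ i < 2 * L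
      p∷₂i<2L = ∷₂-<-2* p (edge-position-< {L = L} e (bounded a) (bounded b))
      k : Fin (2 * L)
      k = fromℕ< p∷₂i<2L
      ⌊k/2⌋≡i : ⌊ toℕ k /2⌋ ≡ i
      ⌊k/2⌋≡i = trans (cong ⌊_/2⌋ (toℕ-fromℕ< p∷₂i<2L)) (⌊[b∷₂m]/2⌋≡m p i)
      parity-k≡p : parity (toℕ k) ≡ p
      parity-k≡p = trans (cong parity (toℕ-fromℕ< p∷₂i<2L)) (parity[b∷₂m]≡b p i)

    satisfied-below : ∀ {u v : Fin n} → ⌊ toℕ v /2⌋ < ⌊ toℕ u /2⌋ →
                      Satisfied hypercubeColouring u v
    satisfied-below {u} {v} lt with exclusiveEdge lt
    ... | i , w , w<u , vw , absent
      with edge-coloured {b = fromℕ< (<-trans w<u (toℕ<n u))}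
             (subst (λ x → Edge (toℕ v) x i 0ℙ) (sym (toℕ-fromℕ< _)) vw)
    ...   | k , vW , refl , even =
      satisfied-by-exclusive vW
        λ x ux → absent (toℕ x) (subst (Edge (toℕ u) (toℕ x) _) even (colouring-sound ux))

    satisfied : ∀ (u v : Fin n) → u ≢ v → Satisfied hypercubeColouring u v
    satisfied u v u≢v with ⌊ toℕ u /2⌋ ≟ ⌊ toℕ v /2⌋
    ... | yes h = let _ , uv , _ = edge-coloured (here (u≢v ∘ toℕ-injective) h refl)
                  in satisfied-by-edge uv
    ... | no h≢ with <-cmp ⌊ toℕ v /2⌋ ⌊ toℕ u /2⌋
    ...   | tri< v<u _ _ = satisfied-below v<u
    ...   | tri≈ _ h _   = contradiction (sym h) h≢
    ...   | tri> _ _ u<v = satisfied-sym (satisfied-below u<v)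

χ'sCF[K]≤2* : n ≤ 2 ^ L → χ'sCF≤ (K n) (2 * L)
χ'sCF[K]≤2* {L = L} n≤2^L =
  hypercubeColouring L , (colouring-sym L , λ _ _ _ → colouring-irrefl L) , satisfied L n≤2^L

mainTheorem9 : ∀ (n : ℕ) → 2 ≤ n → χ'sCF≤ (K n) (2 * ⌈log₂ n ⌉)
mainTheorem9 n _ = χ'sCF[K]≤2* {L = ⌈log₂ n ⌉} (n≤2^⌈log₂n⌉ n)
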